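{- Let $p,q\ge3$ with $(p-2)(q-2)>4$. The continued fraction expansion of $\beta$ is $[q-4;\overline{1,q-6}]$ if $p=3$ and $q\ge7$; $[q-3;\overline{2,q-4}]$ if $p=4$ and $q\ge5$; $[q-3;\overline{1,p-4,1,q-4}]$ if $p,q>4$; $[1;1,\overline{p-4,2}]$ if $p\ge5$ and $q=4$; $[0;1,p-5,\overline{1,p-6}]$ if $p\ge7$ and $q=3$.
   Context: $\beta=\frac{(p-2)(q-2)+\sqrt{(p-2)^2(q-2)^2-4(p-2)(q-2)}}{2(p-2)}$, the larger root of $(p-2)\beta^2-(p-2)(q-2)\beta+(q-2)=0$. An overline denotes a periodically repeated block of partial quotients. -}

module Defs where

open import Data.Nat as ℕ using (ℕ; zero; suc; _∸_)
open import Data.Nat.DivMod using (_mod_)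
open import Data.Fin using (Fin)
open import Data.List using (List; []; _∷_)
open import Data.Vec using (Vec; lookup)
open import Data.Integer using (ℤ; +_; _*_; _-_; _+_; _≤_; _<_; 0ℤ; 1ℤ)
open import Data.Product using (Σ; _×_)
open import Data.Sum using (_⊎_)
open import Relation.Binary.PropositionalEquality using (_≡_; _≢_)

-- Comparisons between an integer m and √D (D ≥ 0), by exact integer
-- arithmetic.

LeSqrt : ℤ → ℤ → Set
LeSqrt m D = m ≤ 0ℤ ⊎ m * m ≤ D

LtSqrt : ℤ → ℤ → Set
LtSqrt m D = m < 0ℤ ⊎ m * m < D

SqrtLe : ℤ → ℤ → Set
SqrtLe D m = 0ℤ ≤ m × D ≤ m * m

SqrtLt : ℤ → ℤ → Set
SqrtLt D m = 0ℤ < m × D < m * m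

-- IsFloor D P Q a  :  a = ⌊ (P + √D) / Q ⌋   (Q ≠ 0),
-- i.e.  a ≤ (P + √D)/Q < a + 1, written out for each sign of Q.

IsFloor : ℤ → ℤ → ℤ → ℤ → Set
IsFloor D P Q a =
    (0ℤ < Q × LeSqrt (a * Q - P) D × SqrtLt D ((a + 1ℤ) * Q - P))
  ⊎ (Q < 0ℤ × SqrtLe D (a * Q - P) × LtSqrt ((a + 1ℤ) * Q - P) D)

-- IsCFExpansion D P₀ Q₀ a : the (regular) continued fraction expansion of
-- x₀ = (P₀ + √D)/Q₀ is a₀, a₁, a₂, …  Here the complete quotients are
-- xₙ = (Pₙ + √D)/Qₙ, with aₙ = ⌊xₙ⌋ and xₙ₊₁ = 1/(xₙ - aₙ); the latter is
-- exactly  Pₙ₊₁ = aₙ Qₙ - Pₙ,  Qₙ₊₁ Qₙ = D - Pₙ₊₁².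

IsCFExpansion : ℤ → ℤ → ℤ → (ℕ → ℤ) → Set
IsCFExpansion D P₀ Q₀ a =
  Σ (ℕ → ℤ) λ P → Σ (ℕ → ℤ) λ Q →
    P 0 ≡ P₀ × Q 0 ≡ Q₀ ×
    ((n : ℕ) → Q n ≢ 0ℤ × IsFloor D (P n) (Q n) (a n)
               × P (suc n) ≡ a n * Q n - P n
               × Q (suc n) * Q n ≡ D - P (suc n) * P (suc n))

-- β = ((p-2)(q-2) + √((p-2)²(q-2)² - 4(p-2)(q-2))) / (2(p-2))
-- written as (βP + √βD) / βQ.

βP : ℕ → ℕ → ℤ
βP p q = + ((p ∸ 2) ℕ.* (q ∸ 2))

βQ : ℕ → ℕ → ℤ
βQ p q = + (2 ℕ.* (p ∸ 2))

βD : ℕ → ℕ → ℤ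
βD p q = + ((p ∸ 2) ℕ.* (p ∸ 2) ℕ.* (q ∸ 2) ℕ.* (q ∸ 2))
       - + (4 ℕ.* (p ∸ 2) ℕ.* (q ∸ 2))

βExpansion : ℕ → ℕ → (ℕ → ℕ) → Set
βExpansion p q a = IsCFExpansion (βD p q) (βP p q) (βQ p q) (λ n → + a n)

-- Eventually periodic sequences: [pre ; overline(per)]
-- cfSeq pre per n = n-th term of pre followed by per repeated forever.

cfSeq : {m : ℕ} → List ℕ → Vec ℕ (suc m) → ℕ → ℕ
cfSeq (x ∷ xs) per zero    = x
cfSeq (x ∷ xs) per (suc n) = cfSeq xs per n
cfSeq {m} []   per n       = lookup per (n mod (suc m))

-- Write A = p − 2, B = q − 2 and D = A²B² − 4AB, so that β = (AB + √D)/(2A).  The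
-- continued fraction algorithm runs on complete quotients xₙ = (Pₙ + √D)/Qₙ with
-- Pₙ₊₁ = aₙQₙ − Pₙ and Qₙ₊₁Qₙ = D − Pₙ₊₁², and for these the condition aₙ = ⌊xₙ⌋ is
-- decided by integer arithmetic alone: when Qₙ > 0 and Qₙ₊₁ ≥ 0 it reduces to the
-- linear inequality Qₙ₊₁ < 2Pₙ₊₁ + Qₙ, which is D < (Pₙ₊₁ + Qₙ)² once D = Pₙ₊₁² + Qₙ₊₁Qₙ
-- is substituted and Qₙ cancelled.  In each of the five cases the complete quotients
-- are polynomials in p and q that repeat with the claimed period, so finitely many
-- polynomial identities and inequalities establish the whole expansion.  Only the
-- first two steps for q = 3 leave the natural numbers, because there β < 1.
module Submission where

open import Data.Integer using (ℤ; +_; -_; 0ℤ; 1ℤ; +≤+; +<+; -≤+; -<+)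
open import Data.Integer.Base using (positive; negative; nonNegative; nonPositive)
open import Data.Integer.Properties
  using ( <⇒≤; <⇒≢; pos-*; i≤i+j; +-identityʳ; +-monoʳ-≤; +-monoʳ-<
        ; *-monoʳ-≤-nonNeg; *-monoʳ-≤-nonPos; *-monoʳ-<-pos; *-monoʳ-<-neg
        ; module ≤-Reasoning)
open import Data.Integer.Tactic.RingSolver using (solve-∀)
open import Data.Fin using (fromℕ<)
open import Data.Fin.Properties using (fromℕ<-cong)
open import Data.List using (List; []; _∷_; [_])
open import Data.Nat as ℕ using (ℕ; zero; suc; z≤n; s≤s; _∸_)
import Data.Nat.Properties as ℕₚ
open import Data.Nat.DivMod using ([m+n]%n≡m%n; m<n⇒m%n≡m)
open import Data.Nat.Tactic.RingSolver using (solve)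
open import Data.Product using (Σ; _×_; _,_; proj₁; proj₂)
open import Data.Sum using (_⊎_; inj₁; inj₂)
open import Data.Vec using (Vec; []; _∷_; lookup; toList)
open import Relation.Binary.PropositionalEquality
  using (_≡_; _≢_; refl; sym; trans; cong; cong₂; subst; ≢-sym; module ≡-Reasoning)
open import Relation.Nullary using (yes; no; contradiction)

open import Defs

module _ where
  open import Data.Integer using (_+_; _*_; _-_; _≤_; _<_)

  CFStep : (D P Q a P′ Q′ : ℤ) → Set
  CFStep D P Q a P′ Q′ =
    Q ≢ 0ℤ × IsFloor D P Q a × P′ ≡ a * Q - P × Q′ * Q ≡ D - P′ * P′

  private
    norm-rearranged : ∀ D P′ Q′ Q → Q′ * Q ≡ D - P′ * P′ → D ≡ P′ * P′ + Q′ * Q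
    norm-rearranged D P′ Q′ Q eq =
      trans (sum-of-difference D (P′ * P′)) (cong (λ t → P′ * P′ + t) (sym eq))
      where
      sum-of-difference : ∀ D S → D ≡ S + (D - S)
      sum-of-difference = solve-∀

    square-of-sum : ∀ P′ Q → P′ * P′ + (P′ + P′ + Q) * Q ≡ (P′ + Q) * (P′ + Q)
    square-of-sum = solve-∀

    next-numerator : ∀ a Q P → (a * Q - P) + Q ≡ (a + 1ℤ) * Q - P
    next-numerator = solve-∀

  isFloor-pos : ∀ {D P Q a P′ Q′} → 0ℤ < Q → P′ ≡ a * Q - P → Q′ * Q ≡ D - P′ * P′ →
    P′ ≤ 0ℤ ⊎ 0ℤ ≤ Q′ → 0ℤ < P′ + Q → Q′ < P′ + P′ + Q → IsFloor D P Q a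
  isFloor-pos {D} {P} {Q} {a} {P′} {Q′} 0<Q P′≡ norm P′≤0⊎0≤Q′ 0<P′+Q Q′<2P′+Q =
    inj₁ (0<Q , subst (λ t → LeSqrt t D) P′≡ (lower P′≤0⊎0≤Q′) ,
          subst (SqrtLt D) (trans (cong (_+ Q) P′≡) (next-numerator a Q P)) (0<P′+Q , upper))
    where
    instance
      Q-positive = positive 0<Q
      Q-nonNegative = nonNegative (<⇒≤ 0<Q)
    open ≤-Reasoning
    lower : P′ ≤ 0ℤ ⊎ 0ℤ ≤ Q′ → LeSqrt P′ D
    lower (inj₁ P′≤0) = inj₁ P′≤0
    lower (inj₂ 0≤Q′) = inj₂ (begin
      P′ * P′           ≤⟨ i≤i+j (P′ * P′) (Q′ * Q) {{nonNegative (*-monoʳ-≤-nonNeg Q 0≤Q′)}} ⟩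
      P′ * P′ + Q′ * Q  ≡⟨ norm-rearranged D P′ Q′ Q norm ⟨
      D                 ∎)
    upper : D < (P′ + Q) * (P′ + Q)
    upper = begin-strict
      D                            ≡⟨ norm-rearranged D P′ Q′ Q norm ⟩
      P′ * P′ + Q′ * Q             <⟨ +-monoʳ-< (P′ * P′) (*-monoʳ-<-pos Q Q′<2P′+Q) ⟩
      P′ * P′ + (P′ + P′ + Q) * Q  ≡⟨ square-of-sum P′ Q ⟩
      (P′ + Q) * (P′ + Q)          ∎

  isFloor-neg : ∀ {D P Q a P′ Q′} → Q < 0ℤ → P′ ≡ a * Q - P → Q′ * Q ≡ D - P′ * P′ →
    0ℤ ≤ P′ → 0ℤ ≤ Q′ → Q′ < P′ + P′ + Q → IsFloor D P Q a
  isFloor-neg {D} {P} {Q} {a} {P′} {Q′} Q<0 P′≡ norm 0≤P′ 0≤Q′ Q′<2P′+Q =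
    inj₂ (Q<0 , subst (SqrtLe D) P′≡ (0≤P′ , upper) ,
          subst (λ t → LtSqrt t D) (trans (cong (_+ Q) P′≡) (next-numerator a Q P)) (inj₂ lower))
    where
    instance
      Q-negative = negative Q<0
      Q-nonPositive = nonPositive (<⇒≤ Q<0)
    open ≤-Reasoning
    upper : D ≤ P′ * P′
    upper = begin
      D                 ≡⟨ norm-rearranged D P′ Q′ Q norm ⟩
      P′ * P′ + Q′ * Q  ≤⟨ +-monoʳ-≤ (P′ * P′) (*-monoʳ-≤-nonPos Q 0≤Q′) ⟩
      P′ * P′ + 0ℤ      ≡⟨ +-identityʳ (P′ * P′) ⟩
      P′ * P′           ∎
    lower : (P′ + Q) * (P′ + Q) < D
    lower = begin-strict
      (P′ + Q) * (P′ + Q)          ≡⟨ square-of-sum P′ Q ⟨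
      P′ * P′ + (P′ + P′ + Q) * Q  <⟨ +-monoʳ-< (P′ * P′) (*-monoʳ-<-neg Q Q′<2P′+Q) ⟩
      P′ * P′ + Q′ * Q             ≡⟨ norm-rearranged D P′ Q′ Q norm ⟨
      D                            ∎

  -- One step (p, q) ↦ (p′, q′) with quotient a for D = A²B² − 4AB, kept in ℕ without
  -- subtraction; growth is q′ < 2p′ + q with the difference made explicit, so that the
  -- ring solver can check it.
  record NatStep (A B a p q p′ q′ : ℕ) : Set where
    constructor natStep
    field
      recurrence : p′ ℕ.+ p ≡ a ℕ.* q
      norm       : q′ ℕ.* q ℕ.+ p′ ℕ.* p′ ℕ.+ 4 ℕ.* A ℕ.* B ≡ A ℕ.* A ℕ.* B ℕ.* B
      growth     : Σ ℕ λ k → suc (q′ ℕ.+ k) ≡ p′ ℕ.+ p′ ℕ.+ q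

  private
    add-sub-cancel : ∀ u v → u + v - v ≡ u
    add-sub-cancel = solve-∀

    add-sub-sub-cancel : ∀ u v w → u + v + w - w - v ≡ u
    add-sub-sub-cancel = solve-∀

    denominator-positive : ∀ {a p q p′ q′} →
      p′ ℕ.+ p ≡ a ℕ.* q → q′ ℕ.< p′ ℕ.+ p′ ℕ.+ q → 0 ℕ.< q
    denominator-positive {a} {q = zero} {p′} recurrence q′<2p′
      with refl ← ℕₚ.m+n≡0⇒m≡0 p′ (trans recurrence (ℕₚ.*-zeroʳ a)) = contradiction q′<2p′ ℕₚ.n≮0
    denominator-positive {q = suc _} _ _ = ℕ.z<s

  NatStep⇒CFStep : ∀ {A B a p q p′ q′} → NatStep A B a p q p′ q′ →
    CFStep (βD (2 ℕ.+ A) (2 ℕ.+ B)) (+ p) (+ q) (+ a) (+ p′) (+ q′)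
  NatStep⇒CFStep {A} {B} {a} {p} {q} {p′} {q′} (natStep recurrence norm (k , growth)) =
    ≢-sym (<⇒≢ 0<q) ,
    isFloor-pos {P = + p} {a = + a} 0<q recurrenceℤ normℤ (inj₂ (+≤+ z≤n)) 0<p′+q (+<+ q′<2p′+q) ,
    recurrenceℤ ,
    normℤ
    where
    q′<2p′+q : q′ ℕ.< p′ ℕ.+ p′ ℕ.+ q
    q′<2p′+q = subst (q′ ℕ.<_) growth (s≤s (ℕₚ.m≤m+n q′ k))
    q-positive : 0 ℕ.< q
    q-positive = denominator-positive {a} {p} {q} {p′} {q′} recurrence q′<2p′+q
    0<q : 0ℤ < + q
    0<q = +<+ q-positive
    0<p′+q : 0ℤ < + p′ + + q
    0<p′+q = +<+ (ℕₚ.<-≤-trans q-positive (ℕₚ.m≤n+m q p′))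
    open ≡-Reasoning
    recurrenceℤ : + p′ ≡ + a * + q - + p
    recurrenceℤ = begin
      + p′                ≡⟨ add-sub-cancel (+ p′) (+ p) ⟨
      + (p′ ℕ.+ p) - + p  ≡⟨ cong (λ t → + t - + p) recurrence ⟩
      + (a ℕ.* q) - + p   ≡⟨ cong (_- + p) (pos-* a q) ⟩
      + a * + q - + p     ∎
    4AB : ℕ
    4AB = 4 ℕ.* A ℕ.* B
    normℤ : + q′ * + q ≡ βD (2 ℕ.+ A) (2 ℕ.+ B) - + p′ * + p′
    normℤ = begin
      + q′ * + q
        ≡⟨ add-sub-sub-cancel (+ q′ * + q) (+ p′ * + p′) (+ 4AB) ⟨
      + q′ * + q + + p′ * + p′ + + 4AB - + 4AB - + p′ * + p′
        ≡⟨ cong (λ t → t + + 4AB - + 4AB - + p′ * + p′) (cong₂ _+_ (pos-* q′ q) (pos-* p′ p′)) ⟨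
      + (q′ ℕ.* q ℕ.+ p′ ℕ.* p′ ℕ.+ 4AB) - + 4AB - + p′ * + p′
        ≡⟨ cong (λ t → + t - + 4AB - + p′ * + p′) norm ⟩
      βD (2 ℕ.+ A) (2 ℕ.+ B) - + p′ * + p′
        ∎

  βD-polynomial : ∀ A B → βD (2 ℕ.+ A) (2 ℕ.+ B) ≡ + A * + A * + B * + B - + 4 * + A * + B
  βD-polynomial A B = cong₂ _-_
    (trans (pos-* (A ℕ.* A ℕ.* B) B)
           (cong (_* + B) (trans (pos-* (A ℕ.* A) B) (cong (_* + B) (pos-* A A)))))
    (trans (pos-* (4 ℕ.* A) B) (cong (_* + B) (pos-* 4 A)))

  βStep₀-q≡3 : ∀ x →
    CFStep (βD (7 ℕ.+ x) 3) (βP (7 ℕ.+ x) 3) (βQ (7 ℕ.+ x) 3) 0ℤ (- + (5 ℕ.+ x)) (- + 2)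
  βStep₀-q≡3 x =
    ≢-sym (<⇒≢ 0<Q) ,
    isFloor-pos {P = βP (7 ℕ.+ x) 3} {a = 0ℤ} 0<Q recurrence norm (inj₁ -≤+) 0<P′+Q Q′<2P′+Q ,
    recurrence ,
    norm
    where
    A : ℤ
    A = + (5 ℕ.+ x)
    βQ≡ : βQ (7 ℕ.+ x) 3 ≡ + 2 * A
    βQ≡ = pos-* 2 (5 ℕ.+ x)
    0<Q : 0ℤ < βQ (7 ℕ.+ x) 3
    0<Q = +<+ ℕ.z<s
    recurrence : - A ≡ 0ℤ * βQ (7 ℕ.+ x) 3 - βP (7 ℕ.+ x) 3
    recurrence = trans (identity A) (sym (cong₂ (λ Q P → 0ℤ * Q - P) βQ≡ (pos-* (5 ℕ.+ x) 1)))
      where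
      identity : ∀ A → - A ≡ 0ℤ * (+ 2 * A) - A * + 1
      identity = solve-∀
    norm : - + 2 * βQ (7 ℕ.+ x) 3 ≡ βD (7 ℕ.+ x) 3 - - A * - A
    norm = trans (cong (λ Q → - + 2 * Q) βQ≡)
                 (trans (identity A) (cong (λ D → D - - A * - A) (sym (βD-polynomial (5 ℕ.+ x) 1))))
      where
      identity : ∀ A → - + 2 * (+ 2 * A) ≡ A * A * + 1 * + 1 - + 4 * A * + 1 - - A * - A
      identity = solve-∀
    0<P′+Q : 0ℤ < - A + βQ (7 ℕ.+ x) 3
    0<P′+Q = subst (0ℤ <_) (trans (identity A) (cong (λ Q → - A + Q) (sym βQ≡))) (+<+ ℕ.z<s)
      where
      identity : ∀ A → A ≡ - A + + 2 * A
      identity = solve-∀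
    Q′<2P′+Q : - + 2 < - A + - A + βQ (7 ℕ.+ x) 3
    Q′<2P′+Q = subst (- + 2 <_) (trans (identity A) (cong (λ Q → - A + - A + Q) (sym βQ≡))) -<+
      where
      identity : ∀ A → 0ℤ ≡ - A + - A + + 2 * A
      identity = solve-∀

  βStep₁-q≡3 : ∀ x → CFStep (βD (7 ℕ.+ x) 3) (- + (5 ℕ.+ x)) (- + 2) 1ℤ (+ (3 ℕ.+ x)) (+ 2)
  βStep₁-q≡3 x =
    <⇒≢ -<+ ,
    isFloor-neg {P = - + (5 ℕ.+ x)} {a = 1ℤ} -<+ recurrence norm (+≤+ z≤n) (+≤+ z≤n) Q′<2P′+Q ,
    recurrence ,
    norm
    where
    recurrence : + (3 ℕ.+ x) ≡ 1ℤ * - + 2 - - + (5 ℕ.+ x)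
    recurrence = identity (+ x)
      where
      identity : ∀ X → + 3 + X ≡ 1ℤ * - + 2 - - (+ 5 + X)
      identity = solve-∀
    norm : + 2 * - + 2 ≡ βD (7 ℕ.+ x) 3 - + (3 ℕ.+ x) * + (3 ℕ.+ x)
    norm = trans (identity (+ x))
                 (cong (λ D → D - + (3 ℕ.+ x) * + (3 ℕ.+ x)) (sym (βD-polynomial (5 ℕ.+ x) 1)))
      where
      identity : ∀ X → + 2 * - + 2 ≡
        (+ 5 + X) * (+ 5 + X) * + 1 * + 1 - + 4 * (+ 5 + X) * + 1 - (+ 3 + X) * (+ 3 + X)
      identity = solve-∀
    Q′<2P′+Q : + 2 < + (3 ℕ.+ x) + + (3 ℕ.+ x) + - + 2
    Q′<2P′+Q = subst (+ 2 <_) (identity (+ x)) (+<+ (s≤s (s≤s (s≤s z≤n))))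
      where
      identity : ∀ X → + 4 + (X + X) ≡ (+ 3 + X) + (+ 3 + X) + - + 2
      identity = solve-∀

open import Data.Nat using (_+_; _*_; _≤_; _<_)

expansion-∷ : ∀ {D P Q P′ Q′ x pre m} {per : Vec ℕ (suc m)} → CFStep D P Q (+ x) P′ Q′ →
  IsCFExpansion D P′ Q′ (λ n → + cfSeq pre per n) →
  IsCFExpansion D P Q (λ n → + cfSeq (x ∷ pre) per n)
expansion-∷ {P = P} {Q} step (Pₙ , Qₙ , refl , refl , steps) =
  (λ { zero → P ; (suc n) → Pₙ n }) , (λ { zero → Q ; (suc n) → Qₙ n }) , refl , refl ,
  λ { zero → step ; (suc n) → steps n }

-- Orbit A B p q as p* q*: natural steps from (p, q) with quotients as, ending at (p*, q*).
-- Each step names its target state, so the ring solver sees the states as polynomials.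
data Orbit (A B : ℕ) : ℕ → ℕ → List ℕ → ℕ → ℕ → Set where
  []       : ∀ {p q} → Orbit A B p q [] p q
  ⟨_,_⟩_∷_ : ∀ {p q a as p* q*} p′ q′ → NatStep A B a p q p′ q′ →
             Orbit A B p′ q′ as p* q* → Orbit A B p q (a ∷ as) p* q*

infixr 5 ⟨_,_⟩_∷_

cfSeq-toList : ∀ {j m} (v : Vec ℕ j) (per : Vec ℕ (suc m)) {n} (n<j : n < j) →
  cfSeq (toList v) per n ≡ lookup v (fromℕ< n<j)
cfSeq-toList (_ ∷ _) per {zero}  _   = refl
cfSeq-toList (_ ∷ v) per {suc n} n<j = cfSeq-toList v per (ℕ.s<s⁻¹ n<j)

cfSeq-drop : ∀ {j m} (v : Vec ℕ j) (per : Vec ℕ (suc m)) n →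
  cfSeq (toList v) per (j + n) ≡ cfSeq [] per n
cfSeq-drop []      per n = refl
cfSeq-drop (_ ∷ v) per n = cfSeq-drop v per n

cfSeq-periodic : ∀ {m} (per : Vec ℕ (suc m)) n → cfSeq [] per (suc m + n) ≡ cfSeq [] per n
cfSeq-periodic {m} per n = cong (lookup per)
  (fromℕ<-cong _ _ (trans (cong (ℕ._% suc m) (ℕₚ.+-comm (suc m) n)) ([m+n]%n≡m%n n (suc m)))
                _ _)

cfSeq-unroll : ∀ {m} (per : Vec ℕ (suc m)) n → cfSeq (toList per) per n ≡ cfSeq [] per n
cfSeq-unroll {m} per n with n ℕₚ.<? suc m
... | yes n<k = trans (cfSeq-toList per per n<k)
                      (cong (lookup per) (fromℕ<-cong _ _ (sym (m<n⇒m%n≡m n<k)) _ _))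
... | no n≮k with ℕₚ.m≤n⇒∃[o]m+o≡n (ℕₚ.≮⇒≥ n≮k)
...   | j , refl = trans (cfSeq-drop per per j) (sym (cfSeq-periodic per j))

stateAt : ∀ {A B m p* q* p q as} {per : Vec ℕ (suc m)} →
  Orbit A B p* q* (toList per) p* q* → Orbit A B p q as p* q* → ℕ → ℕ × ℕ
stateAt {p = p} {q} _ _ zero = p , q
stateAt cycle (⟨ _ , _ ⟩ _ ∷ o) (suc n) = stateAt cycle o n
stateAt {per = _ ∷ _} cycle@(⟨ _ , _ ⟩ _ ∷ cycle′) [] (suc n) = stateAt cycle cycle′ n

NatStepBetween : ℕ → ℕ → ℕ → ℕ × ℕ → ℕ × ℕ → Set
NatStepBetween A B a s s′ = NatStep A B a (proj₁ s) (proj₂ s) (proj₁ s′) (proj₂ s′)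

stepAt : ∀ {A B m p* q* p q pre} {per : Vec ℕ (suc m)}
  (cycle : Orbit A B p* q* (toList per) p* q*) (o : Orbit A B p q pre p* q*) n →
  NatStepBetween A B (cfSeq pre per n) (stateAt cycle o n) (stateAt cycle o (suc n))
stepAt cycle (⟨ _ , _ ⟩ step ∷ _) zero    = step
stepAt cycle (⟨ _ , _ ⟩ _ ∷ o)    (suc n) = stepAt cycle o n
stepAt {per = _ ∷ _} cycle@(⟨ _ , _ ⟩ step ∷ _) [] zero = step
stepAt {A = A} {B} {per = per@(_ ∷ _)} cycle@(⟨ _ , _ ⟩ _ ∷ cycle′) [] (suc n) =
  subst (λ a → NatStepBetween A B a (stateAt cycle cycle′ n) (stateAt cycle cycle′ (suc n)))
        (cfSeq-unroll per (suc n)) (stepAt cycle cycle′ n)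

orbit-expansion : ∀ A B p q {m} (pre : List ℕ) (per : Vec ℕ (suc m)) {p* q*} →
  Orbit A B p q pre p* q* → Orbit A B p* q* (toList per) p* q* →
  IsCFExpansion (βD (2 + A) (2 + B)) (+ p) (+ q) (λ n → + cfSeq pre per n)
orbit-expansion A B p q pre per preperiod cycle =
  (λ n → + proj₁ (stateAt cycle preperiod n)) , (λ n → + proj₂ (stateAt cycle preperiod n)) ,
  refl , refl ,
  λ n → NatStep⇒CFStep (stepAt cycle preperiod n)

βExpansion-4<p-4<q : ∀ {p q} → 4 < p → 4 < q →
  βExpansion p q (cfSeq (q ∸ 3 ∷ []) (1 ∷ p ∸ 4 ∷ 1 ∷ q ∸ 4 ∷ []))
βExpansion-4<p-4<q 4<p 4<q with ℕₚ.m≤n⇒∃[o]m+o≡n 4<p | ℕₚ.m≤n⇒∃[o]m+o≡n 4<q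
... | x , refl | y , refl =
  orbit-expansion (3 + x) (3 + y) ((3 + x) * (3 + y)) (2 * (3 + x))
    [ 2 + y ] (1 ∷ 1 + x ∷ 1 ∷ 1 + y ∷ [])
    (⟨ (3 + x) * (1 + y) , 2 * (3 + 2 * x + 2 * y + x * y) ⟩
       natStep (solve xy) (solve xy) (5 + 2 * y , solve xy) ∷ [])
    (⟨ (1 + x) * (3 + y) , 2 * (3 + y) ⟩
       natStep (solve xy) (solve xy) (5 + 10 * x + 4 * y + 4 * x * y , solve xy) ∷
     ⟨ (1 + x) * (3 + y) , 2 * (3 + 2 * x + 2 * y + x * y) ⟩
       natStep (solve xy) (solve xy) (5 + 2 * x , solve xy) ∷
     ⟨ (3 + x) * (1 + y) , 2 * (3 + x) ⟩
       natStep (solve xy) (solve xy) (5 + 4 * x + 10 * y + 4 * x * y , solve xy) ∷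
     ⟨ (3 + x) * (1 + y) , 2 * (3 + 2 * x + 2 * y + x * y) ⟩
       natStep (solve xy) (solve xy) (5 + 2 * y , solve xy) ∷ [])
  where
  xy : List ℕ
  xy = x ∷ y ∷ []

βExpansion-p≡3 : ∀ {p q} → p ≡ 3 → 7 ≤ q → βExpansion p q (cfSeq (q ∸ 4 ∷ []) (1 ∷ q ∸ 6 ∷ []))
βExpansion-p≡3 refl 7≤q with ℕₚ.m≤n⇒∃[o]m+o≡n 7≤q
... | y , refl =
  orbit-expansion 1 (5 + y) (1 * (5 + y)) (2 * 1) [ 3 + y ] (1 ∷ 1 + y ∷ [])
    (⟨ 1 + y , 2 * (1 + y) ⟩ natStep (solve [ y ]) (solve [ y ]) (1 , solve [ y ]) ∷ [])
    (⟨ 1 + y , 2 ⟩           natStep (solve [ y ]) (solve [ y ]) (1 + 4 * y , solve [ y ]) ∷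
     ⟨ 1 + y , 2 * (1 + y) ⟩ natStep (solve [ y ]) (solve [ y ]) (1 , solve [ y ]) ∷ [])

βExpansion-p≡4 : ∀ {p q} → p ≡ 4 → 5 ≤ q → βExpansion p q (cfSeq (q ∸ 3 ∷ []) (2 ∷ q ∸ 4 ∷ []))
βExpansion-p≡4 refl 5≤q with ℕₚ.m≤n⇒∃[o]m+o≡n 5≤q
... | y , refl =
  orbit-expansion 2 (3 + y) (2 * (3 + y)) (2 * 2) [ 2 + y ] (2 ∷ 1 + y ∷ [])
    (⟨ 2 * (1 + y) , 2 * (1 + y) ⟩ natStep (solve [ y ]) (solve [ y ]) (5 + 2 * y , solve [ y ]) ∷ [])
    (⟨ 2 * (1 + y) , 4 ⟩           natStep (solve [ y ]) (solve [ y ]) (1 + 6 * y , solve [ y ]) ∷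
     ⟨ 2 * (1 + y) , 2 * (1 + y) ⟩ natStep (solve [ y ]) (solve [ y ]) (5 + 2 * y , solve [ y ]) ∷ [])

βExpansion-q≡4 : ∀ {p q} → 5 ≤ p → q ≡ 4 → βExpansion p q (cfSeq (1 ∷ 1 ∷ []) (p ∸ 4 ∷ 2 ∷ []))
βExpansion-q≡4 5≤p refl with ℕₚ.m≤n⇒∃[o]m+o≡n 5≤p
... | x , refl =
  orbit-expansion (3 + x) 2 ((3 + x) * 2) (2 * (3 + x)) (1 ∷ 1 ∷ []) (1 + x ∷ 2 ∷ [])
    (⟨ 0 , 2 * (1 + x) ⟩           natStep (solve [ x ]) (solve [ x ]) (3 , solve [ x ]) ∷
     ⟨ 2 * (1 + x) , 4 ⟩           natStep (solve [ x ]) (solve [ x ]) (1 + 6 * x , solve [ x ]) ∷ [])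
    (⟨ 2 * (1 + x) , 2 * (1 + x) ⟩ natStep (solve [ x ]) (solve [ x ]) (5 + 2 * x , solve [ x ]) ∷
     ⟨ 2 * (1 + x) , 4 ⟩           natStep (solve [ x ]) (solve [ x ]) (1 + 6 * x , solve [ x ]) ∷ [])

βExpansion-q≡3 : ∀ {p q} → 7 ≤ p → q ≡ 3 →
  βExpansion p q (cfSeq (0 ∷ 1 ∷ p ∸ 5 ∷ []) (1 ∷ p ∸ 6 ∷ []))
βExpansion-q≡3 7≤p refl with ℕₚ.m≤n⇒∃[o]m+o≡n 7≤p
... | x , refl =
  expansion-∷ (βStep₀-q≡3 x) (expansion-∷ (βStep₁-q≡3 x)
    (orbit-expansion (5 + x) 1 (3 + x) 2 [ 2 + x ] (1 ∷ 1 + x ∷ [])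
      (⟨ 1 + x , 2 * (1 + x) ⟩ natStep (solve [ x ]) (solve [ x ]) (1 , solve [ x ]) ∷ [])
      (⟨ 1 + x , 2 ⟩           natStep (solve [ x ]) (solve [ x ]) (1 + 4 * x , solve [ x ]) ∷
       ⟨ 1 + x , 2 * (1 + x) ⟩ natStep (solve [ x ]) (solve [ x ]) (1 , solve [ x ]) ∷ [])))

-- The side conditions 3 ≤ p, 3 ≤ q and 4 < (p − 2)(q − 2) follow from those of each case.
lemma4p1 : (p q : ℕ) → 3 ≤ p → 3 ≤ q → 4 < (p ∸ 2) * (q ∸ 2) →
    (p ≡ 3 → 7 ≤ q → βExpansion p q (cfSeq (q ∸ 4 ∷ []) (1 ∷ q ∸ 6 ∷ [])))
    × (p ≡ 4 → 5 ≤ q → βExpansion p q (cfSeq (q ∸ 3 ∷ []) (2 ∷ q ∸ 4 ∷ [])))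
    × (4 < p → 4 < q → βExpansion p q (cfSeq (q ∸ 3 ∷ []) (1 ∷ p ∸ 4 ∷ 1 ∷ q ∸ 4 ∷ [])))
    × (5 ≤ p → q ≡ 4 → βExpansion p q (cfSeq (1 ∷ 1 ∷ []) (p ∸ 4 ∷ 2 ∷ [])))
    × (7 ≤ p → q ≡ 3 → βExpansion p q (cfSeq (0 ∷ 1 ∷ p ∸ 5 ∷ []) (1 ∷ p ∸ 6 ∷ [])))
lemma4p1 p q _ _ _ =
  βExpansion-p≡3 , βExpansion-p≡4 , βExpansion-4<p-4<q , βExpansion-q≡4 , βExpansion-q≡3
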